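{- Let $s,t$ be integers. If $t<0$, then \[ \sqrt{s^2t^2+t}=\begin{cases}[-st-1,\overline{1,2s-2,1,2(-st-1)}] & \text{if } s\ge2,\\ [-t-1,\overline{2,-2t-2}] & \text{if } s=1,\ t\neq-1,\end{cases} \] and \[ \sqrt{s^2t^2+2t}=\begin{cases}[-st-1,\overline{1,s-2,1,2(-st-1)}] & \text{if } s\ge3,\\ [-2t-1,\overline{2,2(-2t-1)}] & \text{if } s=2,\\ [-t-2,\overline{1,2(-t-2)}] & \text{if } s=1,\ t\neq-1,-2.\end{cases} \] If $t>0$ and $s<0$, then \[ \sqrt{16t^2s^4+8ts^3+(8t^2+1)s^2+6ts+t^2+1}=[s+(4s^2+1)t-1,\overline{1,-2s-1,-2s-1,1,2(s+(4s^2+1)t-1)}]. \]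
   Context: $[c_0,c_1,c_2,\dots]=c_0+\cfrac{1}{c_1+\cfrac{1}{c_2+\cdots}}$ denotes the (convergent) continued fraction, and $[b,\overline{a_1,\dots,a_l}]$ denotes $[b,a_1,\dots,a_l,a_1,\dots,a_l,\dots]$. -}

module Defs where

open import Data.Nat using (ℕ; zero; suc; _≤_)
open import Data.Nat.DivMod using (_mod_)
open import Data.Integer using (ℤ; +_; _+_; _*_; _<_)
open import Data.Vec using (Vec; lookup; _∷_; [])
open import Data.Product using (_×_; _,_; proj₁; proj₂; ∃-syntax)
open import Data.Sum using (_⊎_)

periodic : {k : ℕ} → ℤ → Vec ℤ (suc k) → ℕ → ℤ
periodic b a zero = b
periodic {k} b a (suc n) = lookup a (n mod suc k)

-- Convergent numerators/denominators via the standard recurrences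
--   p₋₁ = 1, p₀ = c₀, p_{n+1} = c_{n+1} p_n + p_{n-1}
--   q₋₁ = 0, q₀ = 1,  q_{n+1} = c_{n+1} q_n + q_{n-1}
-- pq c n = ((p_n , q_n) , (p_{n-1} , q_{n-1}))
pq : (ℕ → ℤ) → ℕ → (ℤ × ℤ) × (ℤ × ℤ)
pq c zero = ((c zero , + 1) , (+ 1 , + 0))
pq c (suc n) with pq c n
... | ((p , q) , (p' , q')) = ((c (suc n) * p + p' , c (suc n) * q + q') , (p , q))

convP convQ : (ℕ → ℤ) → ℕ → ℤ
convP c n = proj₁ (proj₁ (pq c n))
convQ c n = proj₂ (proj₁ (pq c n))

-- For D > 0 and N ≥ 0 :  a / D < √N   (√N the nonnegative real square root)
BelowSqrt : ℤ → ℤ → ℤ → Set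
BelowSqrt N a D = (a < + 0) ⊎ (a * a < N * (D * D))

-- For D > 0 and N ≥ 0 :  √N < b / D
AboveSqrt : ℤ → ℤ → ℤ → Set
AboveSqrt N b D = (+ 0 < b) × (N * (D * D) < b * b)

-- √N = [c₀, c₁, c₂, …] : the convergents p_n/q_n converge to √N, i.e.
-- for every m ≥ 1 there is K such that for all n ≥ K, q_n > 0 and
--   |p_n/q_n − √N| < 1/m,  i.e.  (m p_n − q_n)/(m q_n) < √N < (m p_n + q_n)/(m q_n).
SqrtCF : ℤ → (ℕ → ℤ) → Set
SqrtCF N c =
  (m : ℕ) → ∃[ K ] ((n : ℕ) → K ≤ n →
    let p = convP c n
        q = convQ c n
        M = + (suc m)
    in (+ 0 < q)
       × BelowSqrt N (M * p + Data.Integer.- q) (M * q)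
       × AboveSqrt N (M * p + q) (M * q))

{-# OPTIONS --safe #-}
-- Write p_n + q_n √N for the n-th convergent of c = [b, ‾a₁, …, a_k, 2b‾].  When the period
-- closes up, i.e. q_{k-1} + b q_k = p_k and p_{k-1} + b p_k = N q_k, one period multiplies the
-- convergents by the fixed quadratic integer w = p_k + q_k √N, and the determinant identity
-- p_k q_{k-1} − p_{k-1} q_k = ±1 becomes N(w) = p_k² − N q_k² = ±1.  Hence the norms
-- p_n² − N q_n² are periodic, so bounded by some E, while q_n ≥ n; and |p_n² − N q_n²| ≤ E
-- forces |p_n / q_n − √N| to be of order E / q_n², so the convergents tend to √N.  Each family
-- of the theorem has one of the period shapes (a, 2b), (1, a, 1, 2b), (1, a, a, 1, 2b), for
-- which closing up amounts to a single polynomial relation between N, a and b.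

module Submission where

open import Defs
open import Data.Integer using (ℤ; +_; -_; _+_; _*_; _-_; _<_; _≤_)
open import Data.Vec using (_∷_; [])
open import Data.Product using (_×_)
open import Relation.Binary.PropositionalEquality using (_≡_; _≢_)

open import Data.Integer using (∣_∣; -[1+_]; +≤+; +<+; -≤+; nonNegative)
import Data.Integer.Properties as ℤP
open import Data.Integer.Tactic.RingSolver using (solve)
-- The variable lists of solve get their own constructor names: the macro cannot resolve
-- constructors overloaded with those of Vec and All.
open import Data.List using () renaming (_∷_ to _∷ᴸ_; [] to []ᴸ)
open import Data.Nat as ℕ using (ℕ; zero; suc; z≤n; s≤s; _⊔_)
import Data.Nat.Properties as ℕP
open import Data.Nat.DivMod using (_%_; _/_; m≡m%n+[m/n]*n; m%n<n; [m+n]%n≡m%n)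
open import Data.Fin.Properties using (fromℕ<-cong)
open import Data.Vec using (Vec; lookup)
open import Data.Vec.Relation.Unary.All using (All; _∷_; [])
open import Data.Vec.Relation.Unary.All.Properties using (lookup⁺)
open import Data.Sum using (inj₁; inj₂)
open import Data.Product using (_,_; proj₁; proj₂)
open import Function using (_∘_)
open import Relation.Binary.PropositionalEquality
  using (refl; sym; trans; cong; cong₂; subst; module ≡-Reasoning)

≤-if-gap : ∀ {x y} d → y ≡ x + d → + 0 ≤ d → x ≤ y
≤-if-gap {x} d refl 0≤d = ℤP.i≤i+j x d {{nonNegative 0≤d}}

<-if-gap : ∀ {x y} d → y ≡ + 1 + x + d → + 0 ≤ d → x < y
<-if-gap d eq 0≤d = ℤP.suc[i]≤j⇒i<j (≤-if-gap d eq 0≤d)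

+-nonNeg : ∀ {i j} → + 0 ≤ i → + 0 ≤ j → + 0 ≤ i + j
+-nonNeg = ℤP.+-mono-≤

*-nonNeg : ∀ {i j} → + 0 ≤ i → + 0 ≤ j → + 0 ≤ i * j
*-nonNeg {i} {j} 0≤i 0≤j =
  subst (_≤ i * j) (ℤP.*-zeroˡ j) (ℤP.*-monoʳ-≤-nonNeg j {{nonNegative 0≤j}} 0≤i)

0≤+ : ∀ n → + 0 ≤ + n
0≤+ _ = +≤+ z≤n

1≤i⇒0≤i : ∀ {i} → + 1 ≤ i → + 0 ≤ i
1≤i⇒0≤i = ℤP.≤-trans (+≤+ z≤n)

i≤j*i : ∀ {i j} → + 1 ≤ j → + 0 ≤ i → i ≤ j * i
i≤j*i {i} {j} 1≤j 0≤i =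
  subst (_≤ j * i) (ℤP.*-identityˡ i) (ℤP.*-monoʳ-≤-nonNeg i {{nonNegative 0≤i}} 1≤j)

1≤2*i : ∀ {i} → + 1 ≤ i → + 1 ≤ + 2 * i
1≤2*i {i} 1≤i = ≤-if-gap (i - + 1 + i) (solve (i ∷ᴸ []ᴸ)) (+-nonNeg (ℤP.i≤j⇒0≤j-i 1≤i) (1≤i⇒0≤i 1≤i))

i≤+∣i∣ : ∀ i → i ≤ + ∣ i ∣
i≤+∣i∣ (+ _)      = ℤP.≤-refl
i≤+∣i∣ -[1+ _ ]   = -≤+

-+∣i∣≤i : ∀ i → - + ∣ i ∣ ≤ i
-+∣i∣≤i (+ _)      = ℤP.neg-≤-pos
-+∣i∣≤i -[1+ _ ]   = ℤP.≤-refl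

Pair : Set
Pair = ℤ × ℤ

step : ℤ → Pair × Pair → Pair × Pair
step a ((p , q) , (p′ , q′)) = ((a * p + p′ , a * q + q′) , (p , q))

-- (x , y) stands for x + y √N, so mul N is multiplication in ℤ[√N] and norm N is its norm.
mul : ℤ → Pair → Pair → Pair
mul N (x , y) (p , q) = (x * p + N * (y * q) , y * p + x * q)

norm : ℤ → Pair → ℤ
norm N (p , q) = p * p - N * (q * q)

norm-mul : ∀ N w u → norm N (mul N w u) ≡ norm N w * norm N u
norm-mul N (x , y) (p , q) = brahmagupta
  where
  brahmagupta : (x * p + N * (y * q)) * (x * p + N * (y * q)) - N * ((y * p + x * q) * (y * p + x * q))
              ≡ (x * x - N * (y * y)) * (p * p - N * (q * q))
  brahmagupta = solve (N ∷ᴸ x ∷ᴸ y ∷ᴸ p ∷ᴸ q ∷ᴸ []ᴸ)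

mul-both : ℤ → Pair → Pair × Pair → Pair × Pair
mul-both N w (u , u′) = (mul N w u , mul N w u′)

step-mul-both : ∀ N w a u → step a (mul-both N w u) ≡ mul-both N w (step a u)
step-mul-both N (x , y) a ((p , q) , (p′ , q′)) = cong (_, _)
  (cong₂ _,_ rational irrational)
  where
  rational : a * (x * p + N * (y * q)) + (x * p′ + N * (y * q′))
           ≡ x * (a * p + p′) + N * (y * (a * q + q′))
  rational = solve (N ∷ᴸ x ∷ᴸ y ∷ᴸ a ∷ᴸ p ∷ᴸ q ∷ᴸ p′ ∷ᴸ q′ ∷ᴸ []ᴸ)
  irrational : a * (y * p + x * q) + (y * p′ + x * q′) ≡ y * (a * p + p′) + x * (a * q + q′)
  irrational = solve (N ∷ᴸ x ∷ᴸ y ∷ᴸ a ∷ᴸ p ∷ᴸ q ∷ᴸ p′ ∷ᴸ q′ ∷ᴸ []ᴸ)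

det : Pair × Pair → ℤ
det ((p , q) , (p′ , q′)) = p * q′ - p′ * q

det-step : ∀ a u → det (step a u) ≡ - det u
det-step a ((p , q) , (p′ , q′)) = identity
  where
  identity : (a * p + p′) * q - p * (a * q + q′) ≡ - (p * q′ - p′ * q)
  identity = solve (a ∷ᴸ p ∷ᴸ q ∷ᴸ p′ ∷ᴸ q′ ∷ᴸ []ᴸ)

∣det-pq∣ : ∀ c n → ∣ det (pq c n) ∣ ≡ 1
∣det-pq∣ c zero = cong (∣_∣ ∘ (_- + 1)) (ℤP.*-zeroʳ (c 0))
∣det-pq∣ c (suc n) = begin
  ∣ det (step (c (suc n)) (pq c n)) ∣  ≡⟨ cong ∣_∣ (det-step (c (suc n)) (pq c n)) ⟩
  ∣ - det (pq c n) ∣                   ≡⟨ ℤP.∣-i∣≡∣i∣ (det (pq c n)) ⟩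
  ∣ det (pq c n) ∣                     ≡⟨ ∣det-pq∣ c n ⟩
  1                                    ∎
  where open ≡-Reasoning

Growth : ℕ → Pair × Pair → Set
Growth n ((p , q) , (p′ , q′)) = (+ n ≤ q) × (+ 1 ≤ q) × (+ suc n ≤ q + q′) × (q ≤ p) × (q′ ≤ p′)

growth-step : ∀ {n a} u → + 1 ≤ a → Growth n u → Growth (suc n) (step a u)
growth-step {n} {a} ((p , q) , (p′ , q′)) 1≤a (_ , 1≤q , 1+n≤q+q′ , q≤p , q′≤p′) =
  1+n≤aq+q′ , ℤP.≤-trans (+≤+ (s≤s z≤n)) 1+n≤aq+q′ , 2+n≤aq+q′+q , aq+q′≤ap+p′ , q≤p
  where
  1+n≤aq+q′ : + suc n ≤ a * q + q′
  1+n≤aq+q′ = ℤP.≤-trans 1+n≤q+q′ (ℤP.+-monoˡ-≤ q′ (i≤j*i 1≤a (1≤i⇒0≤i 1≤q)))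
  2+n≤aq+q′+q : + suc (suc n) ≤ a * q + q′ + q
  2+n≤aq+q′+q = subst (_ ≤_) (ℤP.+-comm q (a * q + q′)) (ℤP.+-mono-≤ 1≤q 1+n≤aq+q′)
  aq+q′≤ap+p′ : a * q + q′ ≤ a * p + p′
  aq+q′≤ap+p′ = ℤP.+-mono-≤ (ℤP.*-monoˡ-≤-nonNeg a {{nonNegative (1≤i⇒0≤i 1≤a)}} q≤p) q′≤p′

growth : ∀ c → (∀ n → + 1 ≤ c n) → ∀ n → Growth n (pq c n)
growth c 1≤c zero = +≤+ z≤n , ℤP.≤-refl , ℤP.≤-refl , 1≤c 0 , +≤+ z≤n
growth c 1≤c (suc n) = growth-step (pq c n) (1≤c (suc n)) (growth c 1≤c n)

approximation : ∀ {N p q M E} → + 1 ≤ M → + 1 ≤ q → q ≤ p → + ∣ norm N (p , q) ∣ ≤ E → M * E < q * q →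
                BelowSqrt N (M * p - q) (M * q) × AboveSqrt N (M * p + q) (M * q)
approximation {N} {p} {q} {M} {E} 1≤M 1≤q q≤p ∣δ∣≤E ME<q² = inj₂ below , 0<Mp+q , above
  where
  -- δ stands for p * p - N * (q * q).
  0≤M : + 0 ≤ M
  0≤M = 1≤i⇒0≤i 1≤M
  0≤q : + 0 ≤ q
  0≤q = 1≤i⇒0≤i 1≤q
  0≤M-1 : + 0 ≤ M - + 1
  0≤M-1 = ℤP.i≤j⇒0≤j-i 1≤M
  0≤p-q : + 0 ≤ p - q
  0≤p-q = ℤP.i≤j⇒0≤j-i q≤p
  0≤E-δ : + 0 ≤ E - (p * p - N * (q * q))
  0≤E-δ = ℤP.i≤j⇒0≤j-i (ℤP.≤-trans (i≤+∣i∣ (norm N (p , q))) ∣δ∣≤E)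
  0≤δ+E : + 0 ≤ (p * p - N * (q * q)) - - E
  0≤δ+E = ℤP.i≤j⇒0≤j-i (ℤP.≤-trans (ℤP.neg-mono-≤ ∣δ∣≤E) (-+∣i∣≤i (norm N (p , q))))
  0≤slack : + 0 ≤ q * q - (+ 1 + M * E)
  0≤slack = ℤP.i≤j⇒0≤j-i (ℤP.i<j⇒suc[i]≤j ME<q²)
  below : (M * p - q) * (M * p - q) < N * (M * q * (M * q))
  below = <-if-gap
    (M - + 1 + M * M * (E - (p * p - N * (q * q))) + M * (q * q - (+ 1 + M * E))
      + q * (+ 2 * M * (p - q) + (M - + 1) * q))
    (solve (N ∷ᴸ p ∷ᴸ q ∷ᴸ M ∷ᴸ E ∷ᴸ []ᴸ))
    (+-nonNeg (+-nonNeg (+-nonNeg 0≤M-1 (*-nonNeg (*-nonNeg 0≤M 0≤M) 0≤E-δ)) (*-nonNeg 0≤M 0≤slack))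
      (*-nonNeg 0≤q (+-nonNeg (*-nonNeg (*-nonNeg (0≤+ 2) 0≤M) 0≤p-q) (*-nonNeg 0≤M-1 0≤q))))
  above : N * (M * q * (M * q)) < (M * p + q) * (M * p + q)
  above = <-if-gap
    (M - + 1 + M * M * ((p * p - N * (q * q)) - - E) + M * (q * q - (+ 1 + M * E))
      + q * (+ 2 * M * (p - q) + (M + + 1) * q))
    (solve (N ∷ᴸ p ∷ᴸ q ∷ᴸ M ∷ᴸ E ∷ᴸ []ᴸ))
    (+-nonNeg (+-nonNeg (+-nonNeg 0≤M-1 (*-nonNeg (*-nonNeg 0≤M 0≤M) 0≤δ+E)) (*-nonNeg 0≤M 0≤slack))
      (*-nonNeg 0≤q (+-nonNeg (*-nonNeg (*-nonNeg (0≤+ 2) 0≤M) 0≤p-q) (*-nonNeg (+-nonNeg 0≤M (0≤+ 1)) 0≤q))))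
  0<Mp+q : + 0 < M * p + q
  0<Mp+q = <-if-gap (M * p + (q - + 1)) (solve (p ∷ᴸ q ∷ᴸ M ∷ᴸ []ᴸ))
    (+-nonNeg (*-nonNeg 0≤M (ℤP.≤-trans 0≤q q≤p)) (ℤP.i≤j⇒0≤j-i 1≤q))

Approximates : ℤ → ℕ → Pair → Set
Approximates N m (p , q) =
  (+ 0 < q) × BelowSqrt N (+ suc m * p - q) (+ suc m * q) × AboveSqrt N (+ suc m * p + q) (+ suc m * q)

late-convergent-approximates : ∀ N m {E n} u → Growth n u → ∣ norm N (proj₁ u) ∣ ℕ.≤ E →
                               suc (suc m ℕ.* E) ℕ.≤ n → Approximates N m (proj₁ u)
late-convergent-approximates N m {E} {n} ((p , q) , _) (n≤q , 1≤q , _ , q≤p , _) ∣δ∣≤E K≤n =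
  ℤP.suc[i]≤j⇒i<j 1≤q , approximation {N} {M = + suc m} (+≤+ (s≤s z≤n)) 1≤q q≤p (+≤+ ∣δ∣≤E) ME<q²
  where
  open ℤP.≤-Reasoning
  ME<q² : + suc m * + E < q * q
  ME<q² = begin-strict
    + suc m * + E          ≡⟨ ℤP.pos-* (suc m) E ⟨
    + (suc m ℕ.* E)        <⟨ +<+ ℕP.≤-refl ⟩
    + suc (suc m ℕ.* E)    ≤⟨ +≤+ K≤n ⟩
    + n                    ≤⟨ n≤q ⟩
    q                      ≤⟨ i≤j*i 1≤q (1≤i⇒0≤i 1≤q) ⟩
    q * q                  ∎

sqrtCF-of-bounded-norm : ∀ N c E → (∀ n → + 1 ≤ c n) → (∀ n → ∣ norm N (proj₁ (pq c n)) ∣ ℕ.≤ E) →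
                         SqrtCF N c
sqrtCF-of-bounded-norm N c E 1≤c bounded m =
  suc (suc m ℕ.* E) , λ n → late-convergent-approximates N m (pq c n) (growth c 1≤c n) (bounded n)

sup : (ℕ → ℕ) → ℕ → ℕ
sup f zero = 0
sup f (suc n) = f n ⊔ sup f n

≤-sup : ∀ f {i n} → i ℕ.< n → f i ℕ.≤ sup f n
≤-sup f {i} {suc n} i<1+n with ℕP.m<1+n⇒m<n∨m≡n i<1+n
... | inj₁ i<n  = ℕP.m≤n⇒m≤o⊔n (f n) (≤-sup f i<n)
... | inj₂ refl = ℕP.m≤m⊔n (f i) (sup f i)

periodic⇒≤sup : ∀ f L .{{_ : ℕ.NonZero L}} → (∀ n → f (n ℕ.+ L) ≡ f n) → ∀ n → f n ℕ.≤ sup f L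
periodic⇒≤sup f L periodic n =
  subst (ℕ._≤ sup f L) (trans (sym (f-mod (n / L) (n % L))) (cong f (sym (m≡m%n+[m/n]*n n L))))
    (≤-sup f (m%n<n n L))
  where
  f-mod : ∀ d r → f (r ℕ.+ d ℕ.* L) ≡ f r
  f-mod zero    r = cong f (ℕP.+-identityʳ r)
  f-mod (suc d) r = begin
    f (r ℕ.+ (L ℕ.+ d ℕ.* L))  ≡⟨ cong (f ∘ (r ℕ.+_)) (ℕP.+-comm L (d ℕ.* L)) ⟩
    f (r ℕ.+ (d ℕ.* L ℕ.+ L))  ≡⟨ cong f (ℕP.+-assoc r (d ℕ.* L) L) ⟨
    f (r ℕ.+ d ℕ.* L ℕ.+ L)    ≡⟨ periodic (r ℕ.+ d ℕ.* L) ⟩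
    f (r ℕ.+ d ℕ.* L)          ≡⟨ f-mod d r ⟩
    f r                        ∎
    where open ≡-Reasoning

Closes : ℤ → ℤ → Pair × Pair → Set
Closes N b ((x , y) , (x′ , y′)) = (x′ + b * x ≡ N * y) × (y′ + b * y ≡ x)

closes⇒step-2b : ∀ N b u → Closes N b u → step (+ 2 * b) u ≡ mul-both N (proj₁ u) ((b , + 1) , (+ 1 , + 0))
closes⇒step-2b N b ((x , y) , (x′ , y′)) (x-closes , y-closes) =
  cong₂ _,_ (cong₂ _,_ rational irrational) (cong₂ _,_ (solve (N ∷ᴸ x ∷ᴸ y ∷ᴸ []ᴸ)) (solve (x ∷ᴸ y ∷ᴸ []ᴸ)))
  where
  open ≡-Reasoning
  rational : + 2 * b * x + x′ ≡ x * b + N * (y * + 1)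
  rational = begin
    + 2 * b * x + x′    ≡⟨ solve (b ∷ᴸ x ∷ᴸ x′ ∷ᴸ []ᴸ) ⟩
    x * b + (x′ + b * x) ≡⟨ cong (_+_ (x * b)) x-closes ⟩
    x * b + N * y        ≡⟨ solve (N ∷ᴸ b ∷ᴸ x ∷ᴸ y ∷ᴸ []ᴸ) ⟩
    x * b + N * (y * + 1) ∎
  irrational : + 2 * b * y + y′ ≡ y * b + x * + 1
  irrational = begin
    + 2 * b * y + y′    ≡⟨ solve (b ∷ᴸ y ∷ᴸ y′ ∷ᴸ []ᴸ) ⟩
    y * b + (y′ + b * y) ≡⟨ cong (_+_ (y * b)) y-closes ⟩
    y * b + x            ≡⟨ solve (b ∷ᴸ x ∷ᴸ y ∷ᴸ []ᴸ) ⟩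
    y * b + x * + 1      ∎

closes⇒norm≡det : ∀ N b u → Closes N b u → norm N (proj₁ u) ≡ det u
closes⇒norm≡det N b ((x , y) , (x′ , y′)) (x-closes , y-closes) = begin
  x * x - N * (y * y)                 ≡⟨ solve (N ∷ᴸ x ∷ᴸ y ∷ᴸ []ᴸ) ⟩
  x * x - N * y * y                   ≡⟨ cong₂ (λ u v → x * u - v * y) (sym y-closes) (sym x-closes) ⟩
  x * (y′ + b * y) - (x′ + b * x) * y ≡⟨ solve (b ∷ᴸ x ∷ᴸ y ∷ᴸ x′ ∷ᴸ y′ ∷ᴸ []ᴸ) ⟩
  x * y′ - x′ * y                     ∎
  where open ≡-Reasoning

sqrtCF-periodic : ∀ N b {k} (a : Vec ℤ (suc k)) → + 1 ≤ b → All (+ 1 ≤_) a →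
                  periodic b a (suc k) ≡ + 2 * b → Closes N b (pq (periodic b a) k) →
                  SqrtCF N (periodic b a)
sqrtCF-periodic N b {k} a 1≤b 1≤a c-last closes =
  sqrtCF-of-bounded-norm N c (sup ∣norm∣ L) 1≤c (periodic⇒≤sup ∣norm∣ L ∣norm∣-periodic)
  where
  open ≡-Reasoning
  c : ℕ → ℤ
  c = periodic b a
  L : ℕ
  L = suc k
  w : Pair
  w = proj₁ (pq c k)

  1≤c : ∀ n → + 1 ≤ c n
  1≤c zero    = 1≤b
  1≤c (suc n) = lookup⁺ 1≤a _

  c-periodic : ∀ n → c (suc (n ℕ.+ L)) ≡ c (suc n)
  c-periodic n = cong (lookup a) (fromℕ<-cong _ _ ([m+n]%n≡m%n n L) _ _)

  shift : ∀ n → pq c (n ℕ.+ L) ≡ mul-both N w (pq c n)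
  shift zero = begin
    step (c L) (pq c k)       ≡⟨ cong (λ cL → step cL (pq c k)) c-last ⟩
    step (+ 2 * b) (pq c k)   ≡⟨ closes⇒step-2b N b (pq c k) closes ⟩
    mul-both N w (pq c 0)         ∎
  shift (suc n) = begin
    step (c (suc (n ℕ.+ L))) (pq c (n ℕ.+ L))  ≡⟨ cong₂ step (c-periodic n) (shift n) ⟩
    step (c (suc n)) (mul-both N w (pq c n))       ≡⟨ step-mul-both N w (c (suc n)) (pq c n) ⟩
    mul-both N w (pq c (suc n))                    ∎

  ∣norm∣ : ℕ → ℕ
  ∣norm∣ n = ∣ norm N (proj₁ (pq c n)) ∣

  ∣norm∣-periodic : ∀ n → ∣norm∣ (n ℕ.+ L) ≡ ∣norm∣ n
  ∣norm∣-periodic n = begin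
    ∣ norm N (proj₁ (pq c (n ℕ.+ L))) ∣           ≡⟨ cong (∣_∣ ∘ norm N ∘ proj₁) (shift n) ⟩
    ∣ norm N (mul N w (proj₁ (pq c n))) ∣         ≡⟨ cong ∣_∣ (norm-mul N w (proj₁ (pq c n))) ⟩
    ∣ norm N w * norm N (proj₁ (pq c n)) ∣        ≡⟨ ℤP.abs-* (norm N w) _ ⟩
    ∣ norm N w ∣ ℕ.* ∣norm∣ n                      ≡⟨ cong (ℕ._* ∣norm∣ n) ∣norm-w∣ ⟩
    1 ℕ.* ∣norm∣ n                                 ≡⟨ ℕP.*-identityˡ (∣norm∣ n) ⟩
    ∣norm∣ n                                       ∎
    where
    ∣norm-w∣ : ∣ norm N w ∣ ≡ 1
    ∣norm-w∣ = trans (cong ∣_∣ (closes⇒norm≡det N b (pq c k) closes)) (∣det-pq∣ c k)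

prevP prevQ : (ℕ → ℤ) → ℕ → ℤ
prevP c n = proj₁ (proj₂ (pq c n))
prevQ c n = proj₂ (proj₂ (pq c n))

sqrtCF-period₂ : ∀ N b a → + 1 ≤ b → + 1 ≤ a → a * N ≡ a * b * b + + 2 * b →
                 SqrtCF N (periodic b (a ∷ + 2 * b ∷ []))
sqrtCF-period₂ N b a 1≤b 1≤a relation =
  sqrtCF-periodic N b (a ∷ + 2 * b ∷ []) 1≤b (1≤a ∷ 1≤2*i 1≤b ∷ []) refl (x-closes , y-closes)
  where
  open ≡-Reasoning
  c : ℕ → ℤ
  c = periodic b (a ∷ + 2 * b ∷ [])
  x-closes : prevP c 1 + b * convP c 1 ≡ N * convQ c 1
  x-closes = begin
    b + b * (a * b + + 1)  ≡⟨ solve (a ∷ᴸ b ∷ᴸ []ᴸ) ⟩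
    a * b * b + + 2 * b    ≡⟨ relation ⟨
    a * N                  ≡⟨ solve (N ∷ᴸ a ∷ᴸ []ᴸ) ⟩
    N * (a * + 1 + + 0)    ∎
  y-closes : prevQ c 1 + b * convQ c 1 ≡ convP c 1
  y-closes = begin
    + 1 + b * (a * + 1 + + 0)  ≡⟨ solve (a ∷ᴸ b ∷ᴸ []ᴸ) ⟩
    a * b + + 1                ∎

sqrtCF-period₄ : ∀ N b a → + 1 ≤ b → + 1 ≤ a →
                 (a + + 2) * N ≡ (a + + 2) * b * b + + 2 * (a + + 1) * b + a →
                 SqrtCF N (periodic b (+ 1 ∷ a ∷ + 1 ∷ + 2 * b ∷ []))
sqrtCF-period₄ N b a 1≤b 1≤a relation =
  sqrtCF-periodic N b (+ 1 ∷ a ∷ + 1 ∷ + 2 * b ∷ []) 1≤b (ℤP.≤-refl ∷ 1≤a ∷ ℤP.≤-refl ∷ 1≤2*i 1≤b ∷ []) refl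
    (x-closes , y-closes)
  where
  open ≡-Reasoning
  c : ℕ → ℤ
  c = periodic b (+ 1 ∷ a ∷ + 1 ∷ + 2 * b ∷ [])
  x-closes : prevP c 3 + b * convP c 3 ≡ N * convQ c 3
  x-closes = begin
    a * (+ 1 * b + + 1) + b + b * (+ 1 * (a * (+ 1 * b + + 1) + b) + (+ 1 * b + + 1))
      ≡⟨ solve (a ∷ᴸ b ∷ᴸ []ᴸ) ⟩
    (a + + 2) * b * b + + 2 * (a + + 1) * b + a  ≡⟨ relation ⟨
    (a + + 2) * N                                ≡⟨ solve (N ∷ᴸ a ∷ᴸ []ᴸ) ⟩
    N * (+ 1 * (a * + 1 + + 1) + + 1)            ∎
  y-closes : prevQ c 3 + b * convQ c 3 ≡ convP c 3
  y-closes = begin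
    a * + 1 + + 1 + b * (+ 1 * (a * + 1 + + 1) + + 1)     ≡⟨ solve (a ∷ᴸ b ∷ᴸ []ᴸ) ⟩
    + 1 * (a * (+ 1 * b + + 1) + b) + (+ 1 * b + + 1)     ∎

sqrtCF-period₅ : ∀ N b a → + 1 ≤ b → + 1 ≤ a →
                 (a * a + + 2 * a + + 2) * N
                   ≡ (a * a + + 2 * a + + 2) * b * b + + 2 * (a * a + a + + 1) * b + a * a + + 1 →
                 SqrtCF N (periodic b (+ 1 ∷ a ∷ a ∷ + 1 ∷ + 2 * b ∷ []))
sqrtCF-period₅ N b a 1≤b 1≤a relation =
  sqrtCF-periodic N b (+ 1 ∷ a ∷ a ∷ + 1 ∷ + 2 * b ∷ []) 1≤b
    (ℤP.≤-refl ∷ 1≤a ∷ 1≤a ∷ ℤP.≤-refl ∷ 1≤2*i 1≤b ∷ []) refl (x-closes , y-closes)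
  where
  open ≡-Reasoning
  c : ℕ → ℤ
  c = periodic b (+ 1 ∷ a ∷ a ∷ + 1 ∷ + 2 * b ∷ [])
  x-closes : prevP c 4 + b * convP c 4 ≡ N * convQ c 4
  x-closes = begin
    a * (a * (+ 1 * b + + 1) + b) + (+ 1 * b + + 1)
      + b * (+ 1 * (a * (a * (+ 1 * b + + 1) + b) + (+ 1 * b + + 1)) + (a * (+ 1 * b + + 1) + b))
      ≡⟨ solve (a ∷ᴸ b ∷ᴸ []ᴸ) ⟩
    (a * a + + 2 * a + + 2) * b * b + + 2 * (a * a + a + + 1) * b + a * a + + 1  ≡⟨ relation ⟨
    (a * a + + 2 * a + + 2) * N                                                ≡⟨ solve (N ∷ᴸ a ∷ᴸ []ᴸ) ⟩
    N * (+ 1 * (a * (a * + 1 + + 1) + + 1) + (a * + 1 + + 1))                 ∎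
  y-closes : prevQ c 4 + b * convQ c 4 ≡ convP c 4
  y-closes = begin
    a * (a * + 1 + + 1) + + 1 + b * (+ 1 * (a * (a * + 1 + + 1) + + 1) + (a * + 1 + + 1))
      ≡⟨ solve (a ∷ᴸ b ∷ᴸ []ᴸ) ⟩
    + 1 * (a * (a * (+ 1 * b + + 1) + b) + (+ 1 * b + + 1)) + (a * (+ 1 * b + + 1) + b)  ∎

-- Partial quotients are bounded below by writing them as 1 plus a polynomial with nonnegative
-- coefficients in quantities that the hypotheses make nonnegative (such as s - 2 and -1 - t).
1≤-st-1 : ∀ {s t} → + 2 ≤ s → t < + 0 → + 1 ≤ - (s * t) - + 1
1≤-st-1 {s} {t} 2≤s t<0 =
  ≤-if-gap ((s - + 2) + + 2 * (- + 1 - t) + (s - + 2) * (- + 1 - t)) (solve (s ∷ᴸ t ∷ᴸ []ᴸ))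
    (+-nonNeg (+-nonNeg 0≤s-2 (*-nonNeg (0≤+ 2) 0≤-1-t)) (*-nonNeg 0≤s-2 0≤-1-t))
  where
  0≤s-2 : + 0 ≤ s - + 2
  0≤s-2 = ℤP.i≤j⇒0≤j-i 2≤s
  0≤-1-t : + 0 ≤ - + 1 - t
  0≤-1-t = ℤP.i≤j⇒0≤j-i (ℤP.i<j⇒i≤pred[j] t<0)

sqrtCF-s²t²+t : ∀ s t → t < + 0 → + 2 ≤ s →
  SqrtCF (s * s * t * t + t)
    (periodic (- (s * t) - + 1) (+ 1 ∷ + 2 * s - + 2 ∷ + 1 ∷ + 2 * (- (s * t) - + 1) ∷ []))
sqrtCF-s²t²+t s t t<0 2≤s =
  sqrtCF-period₄ (s * s * t * t + t) (- (s * t) - + 1) (+ 2 * s - + 2) (1≤-st-1 2≤s t<0)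
    (≤-if-gap (+ 2 * (s - + 2) + + 1) (solve (s ∷ᴸ []ᴸ)) (+-nonNeg (*-nonNeg (0≤+ 2) (ℤP.i≤j⇒0≤j-i 2≤s)) (0≤+ 1)))
    (solve (s ∷ᴸ t ∷ᴸ []ᴸ))

sqrtCF-t²+t : ∀ s t → t < + 0 → s ≡ + 1 → t ≢ - (+ 1) →
  SqrtCF (s * s * t * t + t) (periodic (- t - + 1) (+ 2 ∷ - (+ 2 * t) - + 2 ∷ []))
sqrtCF-t²+t .(+ 1) t t<0 refl t≢-1 =
  subst (λ d → SqrtCF (+ 1 * + 1 * t * t + t) (periodic (- t - + 1) (+ 2 ∷ d ∷ []))) last≡2b
    (sqrtCF-period₂ (+ 1 * + 1 * t * t + t) (- t - + 1) (+ 2)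
      (≤-if-gap (- + 2 - t) (solve (t ∷ᴸ []ᴸ)) (ℤP.i≤j⇒0≤j-i t≤-2)) (+≤+ (s≤s z≤n)) (solve (t ∷ᴸ []ᴸ)))
  where
  last≡2b : + 2 * (- t - + 1) ≡ - (+ 2 * t) - + 2
  last≡2b = solve (t ∷ᴸ []ᴸ)
  t≤-2 : t ≤ - + 2
  t≤-2 = ℤP.i<j⇒i≤pred[j] (ℤP.≤∧≢⇒< (ℤP.i<j⇒i≤pred[j] t<0) t≢-1)

sqrtCF-s²t²+2t : ∀ s t → t < + 0 → + 3 ≤ s →
  SqrtCF (s * s * t * t + + 2 * t)
    (periodic (- (s * t) - + 1) (+ 1 ∷ s - + 2 ∷ + 1 ∷ + 2 * (- (s * t) - + 1) ∷ []))
sqrtCF-s²t²+2t s t t<0 3≤s =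
  sqrtCF-period₄ (s * s * t * t + + 2 * t) (- (s * t) - + 1) (s - + 2)
    (1≤-st-1 (ℤP.≤-trans (+≤+ (s≤s (s≤s z≤n))) 3≤s) t<0)
    (≤-if-gap (s - + 3) (solve (s ∷ᴸ []ᴸ)) (ℤP.i≤j⇒0≤j-i 3≤s))
    (solve (s ∷ᴸ t ∷ᴸ []ᴸ))

sqrtCF-4t²+2t : ∀ s t → t < + 0 → s ≡ + 2 →
  SqrtCF (s * s * t * t + + 2 * t) (periodic (- (+ 2 * t) - + 1) (+ 2 ∷ + 2 * (- (+ 2 * t) - + 1) ∷ []))
sqrtCF-4t²+2t .(+ 2) t t<0 refl =
  sqrtCF-period₂ (+ 2 * + 2 * t * t + + 2 * t) (- (+ 2 * t) - + 1) (+ 2)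
    (≤-if-gap (+ 2 * (- + 1 - t)) (solve (t ∷ᴸ []ᴸ)) (*-nonNeg (0≤+ 2) (ℤP.i≤j⇒0≤j-i (ℤP.i<j⇒i≤pred[j] t<0))))
    (+≤+ (s≤s z≤n)) (solve (t ∷ᴸ []ᴸ))

sqrtCF-t²+2t : ∀ s t → t < + 0 → s ≡ + 1 → t ≢ - (+ 1) → t ≢ - (+ 2) →
  SqrtCF (s * s * t * t + + 2 * t) (periodic (- t - + 2) (+ 1 ∷ + 2 * (- t - + 2) ∷ []))
sqrtCF-t²+2t .(+ 1) t t<0 refl t≢-1 t≢-2 =
  sqrtCF-period₂ (+ 1 * + 1 * t * t + + 2 * t) (- t - + 2) (+ 1)
    (≤-if-gap (- + 3 - t) (solve (t ∷ᴸ []ᴸ)) (ℤP.i≤j⇒0≤j-i t≤-3)) ℤP.≤-refl (solve (t ∷ᴸ []ᴸ))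
  where
  t≤-3 : t ≤ - + 3
  t≤-3 = ℤP.i<j⇒i≤pred[j] (ℤP.≤∧≢⇒< (ℤP.i<j⇒i≤pred[j] (ℤP.≤∧≢⇒< (ℤP.i<j⇒i≤pred[j] t<0) t≢-1)) t≢-2)

sqrtCF-16t²s⁴+⋯ : ∀ s t → + 0 < t → s < + 0 →
  SqrtCF (+ 16 * t * t * s * s * s * s + + 8 * t * s * s * s + (+ 8 * t * t + + 1) * s * s + + 6 * t * s + t * t + + 1)
    (periodic (s + (+ 4 * s * s + + 1) * t - + 1)
      (+ 1 ∷ - (+ 2 * s) - + 1 ∷ - (+ 2 * s) - + 1 ∷ + 1 ∷ + 2 * (s + (+ 4 * s * s + + 1) * t - + 1) ∷ []))
sqrtCF-16t²s⁴+⋯ s t 0<t s<0 =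
  sqrtCF-period₅
    (+ 16 * t * t * s * s * s * s + + 8 * t * s * s * s + (+ 8 * t * t + + 1) * s * s + + 6 * t * s + t * t + + 1)
    (s + (+ 4 * s * s + + 1) * t - + 1) (- (+ 2 * s) - + 1)
    (≤-if-gap (+ 2 + (- + 1 - s) * (+ 7 + + 4 * (- + 1 - s))
                 + (t - + 1) * (+ 5 + + 4 * (- + 1 - s) * (+ 2 + (- + 1 - s))))
      (solve (s ∷ᴸ t ∷ᴸ []ᴸ))
      (+-nonNeg (+-nonNeg (0≤+ 2) (*-nonNeg 0≤-1-s (+-nonNeg (0≤+ 7) (*-nonNeg (0≤+ 4) 0≤-1-s))))
        (*-nonNeg 0≤t-1 (+-nonNeg (0≤+ 5) (*-nonNeg (*-nonNeg (0≤+ 4) 0≤-1-s) (+-nonNeg (0≤+ 2) 0≤-1-s))))))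
    (≤-if-gap (+ 2 * (- + 1 - s)) (solve (s ∷ᴸ []ᴸ)) (*-nonNeg (0≤+ 2) 0≤-1-s))
    (solve (s ∷ᴸ t ∷ᴸ []ᴸ))
  where
  0≤-1-s : + 0 ≤ - + 1 - s
  0≤-1-s = ℤP.i≤j⇒0≤j-i (ℤP.i<j⇒i≤pred[j] s<0)
  0≤t-1 : + 0 ≤ t - + 1
  0≤t-1 = ℤP.i≤j⇒0≤j-i (ℤP.i<j⇒suc[i]≤j 0<t)

lemma4p1 : (s t : ℤ) →
  (t < + 0 →
    ((+ 2 ≤ s → SqrtCF (s * s * t * t + t)
        (periodic (- (s * t) - + 1) (+ 1 ∷ + 2 * s - + 2 ∷ + 1 ∷ + 2 * (- (s * t) - + 1) ∷ [])))
    × (s ≡ + 1 → t ≢ - (+ 1) → SqrtCF (s * s * t * t + t)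
        (periodic (- t - + 1) (+ 2 ∷ - (+ 2 * t) - + 2 ∷ [])))
    × (+ 3 ≤ s → SqrtCF (s * s * t * t + + 2 * t)
        (periodic (- (s * t) - + 1) (+ 1 ∷ s - + 2 ∷ + 1 ∷ + 2 * (- (s * t) - + 1) ∷ [])))
    × (s ≡ + 2 → SqrtCF (s * s * t * t + + 2 * t)
        (periodic (- (+ 2 * t) - + 1) (+ 2 ∷ + 2 * (- (+ 2 * t) - + 1) ∷ [])))
    × (s ≡ + 1 → t ≢ - (+ 1) → t ≢ - (+ 2) → SqrtCF (s * s * t * t + + 2 * t)
        (periodic (- t - + 2) (+ 1 ∷ + 2 * (- t - + 2) ∷ [])))))
  × (+ 0 < t → s < + 0 →
    SqrtCF (+ 16 * t * t * s * s * s * s + + 8 * t * s * s * s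
            + (+ 8 * t * t + + 1) * s * s + + 6 * t * s + t * t + + 1)
      (periodic (s + (+ 4 * s * s + + 1) * t - + 1)
        (+ 1 ∷ - (+ 2 * s) - + 1 ∷ - (+ 2 * s) - + 1 ∷ + 1
          ∷ + 2 * (s + (+ 4 * s * s + + 1) * t - + 1) ∷ [])))
lemma4p1 s t =
  (λ t<0 → sqrtCF-s²t²+t s t t<0 , sqrtCF-t²+t s t t<0 , sqrtCF-s²t²+2t s t t<0
          , sqrtCF-4t²+2t s t t<0 , sqrtCF-t²+2t s t t<0)
  , sqrtCF-16t²s⁴+⋯ s t
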